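{- Let $X$ be a permutation of $[n]$ avoiding $(2,3,1)$, $T$ an initial tree and $G(X)=G_T(X)$. Then there are no keys $a<b<c$ and times $t_1<t_2$ such that $(a,t_2),(c,t_2)\in TL\cup TR$ and $(b,t_1)\in X$.
   Context: $X=(x_1,\dots,x_n)$ is identified with the point set $\{(x_t,t)\}$. Geometric Greedy $G_T(X)$: the initial BST $T$ is encoded by a fixed point set in rows $-(n-1),\dots,0$ (standard geometric encoding); for $t=1,\dots,n$, with $p=(x_t,t)$ and, for each key $a$, $q=(a,\tau(a,t))$ where $\tau(a,t)$ is the last row $<t$ with a point in column $a$, add $(a,t)$ iff the closed rectangle with corners $p,q$ contains no other point; $G_T(X)$ is the set of points added in rows $1,\dots,n$. For $q\in G(X)\setminus X$ let $p_1\in X$ be the unique input point with $p_1.x=q.x$ and $p_2\in X$ the unique input point with $p_2.y=q.y$. $q\in B$ if $p_1.y<q.y$, $q\in T$ otherwise; $q\in R$ if $p_2.x>q.x$, $q\in L$ if $p_2.x<q.x$. $TR=T\cap R$, $TL=T\cap L$. -}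

module Defs where

open import Data.Nat using (ℕ; zero; suc; _≤_; _<_; _⊓_; _⊔_)
open import Data.Integer as ℤ using (ℤ; +_; -_)
open import Data.List using (List; []; _∷_; _++_; map; upTo)
open import Data.Product using (_×_; ∃-syntax)
open import Data.Sum using (_⊎_)
open import Relation.Binary.PropositionalEquality using (_≡_)
open import Relation.Nullary using (¬_)

data BTree : Set where
  leaf : BTree
  node : BTree → ℕ → BTree → BTree

inorder : BTree → List ℕ
inorder leaf         = []
inorder (node l k r) = inorder l ++ k ∷ inorder r

IsBSTOn : ℕ → BTree → Set
IsBSTOn n T = inorder T ≡ map suc (upTo n)

data _∋_atDepth_ : BTree → ℕ → ℕ → Set where
  here  : ∀ {l k r} → node l k r ∋ k atDepth 0
  left  : ∀ {l k r a d} → l ∋ a atDepth d → node l k r ∋ a atDepth suc d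
  right : ∀ {l k r a d} → r ∋ a atDepth d → node l k r ∋ a atDepth suc d

-- Access sequences: x t is x_t for t ∈ [n] (values outside [n] irrelevant)

InRange : ℕ → ℕ → Set
InRange n t = 1 ≤ t × t ≤ n

IsPerm : ℕ → (ℕ → ℕ) → Set
IsPerm n x = (∀ t → InRange n t → InRange n (x t))
           × (∀ s t → InRange n s → InRange n t → x s ≡ x t → s ≡ t)

Avoids231 : ℕ → (ℕ → ℕ) → Set
Avoids231 n x = ¬ (∃[ i ] ∃[ j ] ∃[ k ]
  (InRange n i × InRange n j × InRange n k × i < j × j < k × x k < x i × x i < x j))

-- Geometric Greedy.  A point set is a predicate P r a  ("(a,r) ∈ P"),
-- rows r ∈ ℤ, columns (keys) a ∈ ℕ.

Between : ℕ → ℕ → ℕ → Set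
Between u v c = (u ⊓ v) ≤ c × c ≤ (u ⊔ v)

LastRow : (ℤ → ℕ → Set) → ℕ → ℤ → Set
LastRow P a τ = P τ a × (∀ r → τ ℤ.< r → ¬ P r a)

-- the closed rectangle with corners p = (px, t+1) and q = (a, τ) contains
-- no point other than q (P holds exactly the points in rows ≤ t; the only
-- point in row t+1 at that moment is the corner p itself)
EmptyRect : (ℤ → ℕ → Set) → ℕ → ℕ → ℤ → Set
EmptyRect P px a τ = ∀ c r → Between a px c → τ ℤ.≤ r → P r c → (c ≡ a × r ≡ τ)

GUpTo : ℕ → (ℕ → ℕ) → BTree → ℕ → ℤ → ℕ → Set
GUpTo n x T zero r a = ∃[ d ] (T ∋ a atDepth d × r ≡ - (+ d))
GUpTo n x T (suc t) r a =
    (r ℤ.≤ + t × GUpTo n x T t r a)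
  ⊎ (r ≡ + suc t × InRange n a ×
       ∃[ τ ] (LastRow (GUpTo n x T t) a τ × EmptyRect (GUpTo n x T t) (x (suc t)) a τ))

InG : ℕ → (ℕ → ℕ) → BTree → ℕ → ℕ → Set
InG n x T a t = InRange n t × GUpTo n x T n (+ t) a

InX : ℕ → (ℕ → ℕ) → ℕ → ℕ → Set
InX n x a t = InRange n t × x t ≡ a

InTop : ℕ → (ℕ → ℕ) → ℕ → ℕ → Set
InTop n x a t = ∃[ s ] (InX n x a s × t ≤ s)

InRight : (ℕ → ℕ) → ℕ → ℕ → Set
InRight x a t = a < x t

InLeft : (ℕ → ℕ) → ℕ → ℕ → Set
InLeft x a t = x t < a

InTR : ℕ → (ℕ → ℕ) → BTree → ℕ → ℕ → Set
InTR n x T a t = InG n x T a t × ¬ InX n x a t × InTop n x a t × InRight x a t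

InTL : ℕ → (ℕ → ℕ) → BTree → ℕ → ℕ → Set
InTL n x T a t = InG n x T a t × ¬ InX n x a t × InTop n x a t × InLeft x a t

-- Since (a, t₂) lies in the top half, a is accessed at a time s > t₂; as x_s = a < b = x_{t₁}, every
-- access x_t with t₁ < t < s is below b (x_t > b would give a 231-pattern). Greedy touches the input
-- point (b, t₁). Hence whenever Greedy touches c > b at a time t₁ < t < s, the previous touch of column c
-- cannot be at or below row t₁ (the rectangle would contain (b, t₁)), so it is an earlier touch of c
-- in the same window; descending, no such touch exists, in particular not (c, t₂).
module Submission where

open import Defs
open import Data.Nat using (ℕ; zero; suc; _<_; _≤_; z≤n; s≤s; _+_; _∸_)
import Data.Nat.Properties as ℕ
open import Data.Nat.Induction using (<-wellFounded)
open import Data.Integer as ℤ using (ℤ; +_; -[1+_]; +≤+; +<+; -<+; -<-)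
import Data.Integer.Properties as ℤ
open import Data.Product using (_×_; ∃-syntax; _,_; proj₁; proj₂; ∃)
open import Data.Sum using (_⊎_; inj₁; inj₂)
open import Data.Empty using (⊥; ⊥-elim)
open import Data.List.Membership.Propositional using (_∈_)
open import Data.List.Membership.Propositional.Properties using (∈-++⁻; ∈-map⁺; ∈-upTo⁺)
open import Data.List.Relation.Unary.Any using (here; there)
open import Function using (_on_)
open import Induction.WellFounded using (Acc; acc)
open import Relation.Binary.Construct.On using (wellFounded)
open import Relation.Binary.Definitions using (tri<; tri≈; tri>)
open import Relation.Binary.PropositionalEquality using (_≡_; refl; sym; subst)
open import Relation.Nullary using (¬_; yes; no)
open import Relation.Nullary.Decidable using (¬¬-excluded-middle)
open import Relation.Nullary.Negation using (¬¬-map)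

inorder-∈⇒atDepth : ∀ T {b} → b ∈ inorder T → ∃[ d ] (T ∋ b atDepth d)
inorder-∈⇒atDepth (node l k r) b∈T with ∈-++⁻ (inorder l) b∈T
... | inj₁ b∈l         = let d , b∈l′ = inorder-∈⇒atDepth l b∈l in suc d , left b∈l′
... | inj₂ (here refl) = 0 , here
... | inj₂ (there b∈r) = let d , b∈r′ = inorder-∈⇒atDepth r b∈r in suc d , right b∈r′

IsBSTOn⇒atDepth : ∀ {n T a} → IsBSTOn n T → InRange n a → ∃[ d ] (T ∋ a atDepth d)
IsBSTOn⇒atDepth {T = T} {suc a} bst (_ , a<n) =
  inorder-∈⇒atDepth T (subst (suc a ∈_) (sym bst) (∈-map⁺ suc (∈-upTo⁺ a<n)))

-- Rows lie in ℤ, so LastRow is only classically available: it is found inside ¬¬,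
-- by recursion on the distance of a row below an upper bound B of its column.
heightBelow : ℕ → ℤ → ℕ
heightBelow B (+ v)    = B ∸ v
heightBelow B -[1+ j ] = B + suc j

heightBelow-< : ∀ {B r₀ r} → r₀ ℤ.< r → r ℤ.≤ + B → heightBelow B r < heightBelow B r₀
heightBelow-< {B} (+<+ v₀<v) (+≤+ v≤B) = ℕ.∸-monoʳ-< v₀<v v≤B
heightBelow-< {B} {r = + v} -<+ _       = ℕ.≤-<-trans (ℕ.m∸n≤m B v) (ℕ.m<m+n B (s≤s z≤n))
heightBelow-< {B} (-<- j′<j) _         = ℕ.+-monoʳ-< B (s≤s j′<j)

¬¬-lastRow : ∀ (P : ℤ → ℕ → Set) {a r₀} B → (∀ {r} → P r a → r ℤ.≤ + B) →
             P r₀ a → ¬ ¬ ∃ (LastRow P a)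
¬¬-lastRow P {a} B bounded = search (wellFounded (heightBelow B) <-wellFounded _)
  where
  search : ∀ {r₀} → Acc (_<_ on heightBelow B) r₀ → P r₀ a → ¬ ¬ ∃ (LastRow P a)
  search {r₀} (acc higher) p₀ noLast =
    ¬¬-excluded-middle {A = ∃[ r ] (r₀ ℤ.< r × P r a)} λ where
    (yes (r , r₀<r , p)) → search (higher (heightBelow-< r₀<r (bounded p))) p noLast
    (no none-higher)     → noLast (r₀ , p₀ , λ r r₀<r p → none-higher (r , r₀<r , p))

LastRow⇒EmptyRect-degenerate : ∀ {P a τ} → LastRow P a τ → EmptyRect P a a τ
LastRow⇒EmptyRect-degenerate {P} {a} {τ} (_ , nothing-above) c r (a⊓a≤c , c≤a⊔a) τ≤r p = c≡a , r≡τ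
  where
  c≡a : c ≡ a
  c≡a = ℕ.≤-antisym (subst (c ≤_) (ℕ.⊔-idem a) c≤a⊔a) (subst (_≤ c) (ℕ.⊓-idem a) a⊓a≤c)
  r≡τ : r ≡ τ
  r≡τ with r ℤ.≟ τ
  ... | yes r≡τ = r≡τ
  ... | no r≢τ  =
    ⊥-elim (nothing-above r (ℤ.≤∧≢⇒< τ≤r (λ τ≡r → r≢τ (sym τ≡r))) (subst (P r) c≡a p))

EmptyRect⇒¬inner : ∀ {P px c τ b r} → EmptyRect P px c τ → P r b → τ ℤ.≤ r → px ≤ b → b < c → ⊥
EmptyRect⇒¬inner {px = px} {c} {b = b} empty p τ≤r px≤b b<c =
  ℕ.<-irrefl (proj₁ (empty _ _ between τ≤r p)) b<c
  where
  between : Between c px b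
  between = ℕ.≤-trans (ℕ.m⊓n≤n c px) px≤b , ℕ.≤-trans (ℕ.<⇒≤ b<c) (ℕ.m≤m⊔n c px)

InRange-between : ∀ {n i j k} → InRange n i → InRange n k → i < j → j < k → InRange n j
InRange-between (1≤i , _) (_ , k≤n) i<j j<k = ℕ.≤-trans 1≤i (ℕ.<⇒≤ i<j) , ℕ.≤-trans (ℕ.<⇒≤ j<k) k≤n

Avoids231⇒below : ∀ {n x i j k} → IsPerm n x → Avoids231 n x → InRange n i → InRange n k →
                  x k < x i → i < j → j < k → x j < x i
Avoids231⇒below {_} {x} {i} {j} {k} (_ , injective) avoids ri rk xk<xi i<j j<k
  with ℕ.<-cmp (x j) (x i)
... | tri< xj<xi _ _ = xj<xi
... | tri≈ _ xj≡xi _ =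
  ⊥-elim (ℕ.<-irrefl (sym (injective j i (InRange-between ri rk i<j j<k) ri xj≡xi)) i<j)
... | tri> _ _ xi<xj =
  ⊥-elim (avoids (i , j , k , ri , InRange-between ri rk i<j j<k , rk , i<j , j<k , xk<xi , xi<xj))

module Greedy (n : ℕ) (x : ℕ → ℕ) (T : BTree) where

  G : ℕ → ℤ → ℕ → Set
  G = GUpTo n x T

  G-row≤ : ∀ t {r a} → G t r a → r ℤ.≤ + t
  G-row≤ zero    (_ , _ , refl)    = ℤ.neg-≤-pos
  G-row≤ (suc t) (inj₁ (r≤t , _))  = ℤ.≤-trans r≤t (+≤+ (ℕ.n≤1+n t))
  G-row≤ (suc t) (inj₂ (refl , _)) = ℤ.≤-refl

  G-mono : ∀ {t s r a} → t ≤ s → G t r a → G s r a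
  G-mono {s = zero}  z≤n p = p
  G-mono {s = suc s} t≤1+s p with ℕ.m≤n⇒m<n∨m≡n t≤1+s
  ... | inj₁ (s≤s t≤s) = inj₁ (G-row≤ s (G-mono t≤s p) , G-mono t≤s p)
  ... | inj₂ refl      = p

  G-restrict : ∀ {t s r a} → t ≤ s → G s r a → r ℤ.≤ + t → G t r a
  G-restrict {s = zero} z≤n p _ = p
  G-restrict {s = suc s} t≤1+s p r≤t with ℕ.m≤n⇒m<n∨m≡n t≤1+s | p
  ... | inj₂ refl      | _                = p
  ... | inj₁ (s≤s t≤s) | inj₁ (_ , p′)    = G-restrict t≤s p′ r≤t
  ... | inj₁ (s≤s t≤s) | inj₂ (refl , _)  with r≤t
  ...   | +≤+ 1+s≤t = ⊥-elim (ℕ.<-irrefl refl (ℕ.≤-trans 1+s≤t t≤s))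

  G-added : ∀ u {a} → G (suc u) (+ suc u) a →
            ∃[ τ ] (LastRow (G u) a τ × EmptyRect (G u) (x (suc u)) a τ)
  G-added u (inj₁ (+≤+ 1+u≤u , _))  = ⊥-elim (ℕ.<-irrefl refl 1+u≤u)
  G-added u (inj₂ (_ , _ , added)) = added

  ¬¬-input∈G : IsBSTOn n T → ∀ {t} → InRange n t → InRange n (x t) → ¬ ¬ G t (+ t) (x t)
  ¬¬-input∈G bst {suc u} _ rxt with IsBSTOn⇒atDepth bst rxt
  ... | d , key = ¬¬-map touched (¬¬-lastRow (G u) u (G-row≤ u) (G-mono z≤n (d , key , refl)))
    where
    touched : ∃ (LastRow (G u) (x (suc u))) → G (suc u) (+ suc u) (x (suc u))
    touched (τ , last) = inj₂ (refl , rxt , τ , last , LastRow⇒EmptyRect-degenerate last)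

  module _ (perm : IsPerm n x) (avoids : Avoids231 n x) {t₁ s c}
           (rt₁ : InRange n t₁) (rs : InRange n s) (xs<xt₁ : x s < x t₁) (xt₁<c : x t₁ < c)
           (input∈G : G t₁ (+ t₁) (x t₁)) where

    ¬column-touched : ∀ u → t₁ ≤ u → suc u < s → ¬ G (suc u) (+ suc u) c
    ¬column-touched u = descend (<-wellFounded u)
      where
      descend : ∀ {u} → Acc _<_ u → t₁ ≤ u → suc u < s → ¬ G (suc u) (+ suc u) c
      descend {u} (acc earlier) t₁≤u 1+u<s touched
        with G-added u touched
      ... | τ , (cτ , _) , empty with τ ℤ.≤? + t₁
      ...   | yes τ≤t₁ =
        EmptyRect⇒¬inner empty (G-mono t₁≤u input∈G) τ≤t₁
          (ℕ.<⇒≤ (Avoids231⇒below perm avoids rt₁ rs xs<xt₁ (s≤s t₁≤u) 1+u<s)) xt₁<c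
      ...   | no τ≰t₁ with ℤ.≰⇒> τ≰t₁ | G-row≤ u cτ
      ...     | +<+ {n = suc u′} (s≤s t₁≤u′) | +≤+ 1+u′≤u =
        descend (earlier 1+u′≤u) t₁≤u′ (ℕ.<-trans (s≤s 1+u′≤u) 1+u<s)
                (G-restrict 1+u′≤u cτ ℤ.≤-refl)

InTL⊎InTR⇒InT : ∀ {n x T a t} → InTL n x T a t ⊎ InTR n x T a t →
                InG n x T a t × ¬ InX n x a t × InTop n x a t
InTL⊎InTR⇒InT (inj₁ (a∈G , a∉X , a∈Top , _)) = a∈G , a∉X , a∈Top
InTL⊎InTR⇒InT (inj₂ (a∈G , a∉X , a∈Top , _)) = a∈G , a∉X , a∈Top

InTop⇒laterAccess : ∀ {n x a t} → ¬ InX n x a t → InTop n x a t → ∃[ s ] (InX n x a s × t < s)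
InTop⇒laterAccess a∉X (s , a∈X , t≤s) with ℕ.m≤n⇒m<n∨m≡n t≤s
... | inj₁ t<s  = s , a∈X , t<s
... | inj₂ refl = ⊥-elim (a∉X a∈X)

mainTheorem18 : (n : ℕ) (x : ℕ → ℕ) → IsPerm n x → Avoids231 n x →
    (T : BTree) → IsBSTOn n T →
    ¬ (∃[ a ] ∃[ b ] ∃[ c ] ∃[ t₁ ] ∃[ t₂ ]
         (a < b × b < c × t₁ < t₂
          × (InTL n x T a t₂ ⊎ InTR n x T a t₂)
          × (InTL n x T c t₂ ⊎ InTR n x T c t₂)
          × InX n x b t₁))
mainTheorem18 n x perm avoids T bst
  (a , b , c , t₁ , suc u , a<b , b<c , s≤s t₁≤u , a∈TL∪TR , c∈TL∪TR , (rt₁ , refl))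
  with InTL⊎InTR⇒InT a∈TL∪TR | InTL⊎InTR⇒InT c∈TL∪TR
... | (rt₂ , _) , a∉X , a∈Top | (_ , c∈G) , _ , _
  with InTop⇒laterAccess a∉X a∈Top
... | s , (rs , refl) , t₂<s =
  ¬¬-input∈G bst rt₁ (proj₁ perm t₁ rt₁) λ input∈G →
    ¬column-touched perm avoids rt₁ rs a<b b<c input∈G u t₁≤u t₂<s
      (G-restrict (proj₂ rt₂) c∈G ℤ.≤-refl)
  where open Greedy n x T
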